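{- If $G$ is a cycle of even length, then $\chi_{DP}^\ast(G) = 2$, while $\theta_{DP}(G, k)^{ -1} > 2$ for all positive integers $k$.
   Context: All graphs are finite, without loops or multiple edges. A cover of a graph $G$ is a pair $(L,H)$ where $H$ is a graph and $L\colon V(G)\to 2^{V(H)}$ satisfies: the sets $L(u)$, $u\in V(G)$, partition $V(H)$; each $H[L(u)]$ is complete; if there is an edge of $H$ between $L(u)$ and $L(v)$ with $u\neq v$ then $uv\in E(G)$; and for each $uv\in E(G)$ the edges of $H$ between $L(u)$ and $L(v)$ form a (not necessarily perfect, possibly empty) matching. The cover is $k$-fold if $|L(u)|=k$ for all $u$. Edges of $H$ joining different sets $L(u)\ne L(v)$ are cross-edges; $S\subseteq V(H)$ is quasi-independent if it spans no cross-edges. For $\eta\in[0,1]$, an $(\eta,(L,H))$-coloring of $G$ is a quasi-independent $S\subseteq V(H)$ with $|S\cap L(u)|\geq \eta|L(u)|$ for all $u\in V(G)$. For $k\in\mathbb{N}^+$, $\theta_{DP}(G,k)$ is the maximum $\eta\in[0,1]$ such that $G$ admits an $(\eta,\mathcal{H})$-coloring for every $k$-fold cover $\mathcal{H}$ of $G$, and $\chi_{DP}^\ast(G)=\inf\{\theta_{DP}(G,k)^{ -1}: k\in\mathbb{N}^+\}$. -}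

module Defs where

open import Data.Nat using (ℕ; zero; suc; _≤_; _*_)
open import Data.Fin using (Fin; toℕ)
open import Data.Fin.Subset using (Subset; _∈_; ∣_∣)
open import Data.Bool using (Bool; true)
open import Data.Product using (Σ; _×_; ∃; _,_)
open import Data.Sum using (_⊎_)
open import Data.Empty using (⊥)
open import Data.Integer using (+_)
open import Data.Rational as ℚ using (ℚ; 0ℚ; 1ℚ)
open import Relation.Binary.PropositionalEquality using (_≡_)
open import Function.Bundles using (_⤖_; Bijection; _⇔_)

ℕ→ℚ : ℕ → ℚ
ℕ→ℚ n = (+ n) ℚ./ 1

record Graph : Set₁ where
  field
    V      : ℕ
    Adj    : Fin V → Fin V → Set
    irrefl : ∀ {u} → Adj u u → ⊥
    sym    : ∀ {u v} → Adj u v → Adj v u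
open Graph public

-- The cycle C_n on vertices 0,…,n-1 (i ~ i+1 mod n); a simple graph for n ≥ 3.
Succ : (n : ℕ) → Fin n → Fin n → Set
Succ n i j = (suc (toℕ i) ≡ toℕ j) ⊎ ((suc (toℕ i) ≡ n) × (toℕ j ≡ 0))

CycleAdj : (n : ℕ) → Fin n → Fin n → Set
CycleAdj n i j = Succ n i j ⊎ Succ n j i

IsCycle : ℕ → Graph → Set
IsCycle n G =
  Σ (Fin (V G) ⤖ Fin n) λ f →
    ∀ u v → Adj G u v ⇔ CycleAdj n (Bijection.to f u) (Bijection.to f v)

-- V(H) = V(G) × Fin k with L(u) = {u} × Fin k
-- (every k-fold cover is isomorphic to one of this shape).  The cliques
-- H[L(u)] are implicit; `cross u i v j` records the cross-edges of H.
record Cover (G : Graph) (k : ℕ) : Set where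
  field
    cross    : Fin (V G) → Fin k → Fin (V G) → Fin k → Bool
    cross-sym : ∀ u i v j → cross u i v j ≡ cross v j u i
    cross-adj : ∀ {u i v j} → cross u i v j ≡ true → Adj G u v
    matching : ∀ {u i v j j′} → cross u i v j ≡ true → cross u i v j′ ≡ true → j ≡ j′
open Cover public

-- S ⊆ V(H), given by S(u) = S ∩ L(u).
QuasiIndependent : {G : Graph} {k : ℕ} → Cover G k → (Fin (V G) → Subset k) → Set
QuasiIndependent {G} {k} H S =
  ∀ u i v j → cross H u i v j ≡ true → i ∈ S u → j ∈ S v → ⊥

Coloring : {G : Graph} {k : ℕ} → ℚ → Cover G k → Set
Coloring {G} {k} η H =
  Σ (Fin (V G) → Subset k) λ S →
    QuasiIndependent H S × (∀ u → η ℚ.* ℕ→ℚ k ℚ.≤ ℕ→ℚ ∣ S u ∣)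

Admits : Graph → ℕ → ℚ → Set
Admits G k η = (H : Cover G k) → Coloring η H

-- θ is θ_DP(G,k): the maximum η ∈ [0,1] with `Admits G k η`.
-- (θ_DP(G,k) is always of the form m/k, hence rational, so the maximum over
-- reals is attained at a rational; maximality is checked against rationals.)
IsθDP : Graph → ℕ → ℚ → Set
IsθDP G k θ =
  (0ℚ ℚ.≤ θ) × (θ ℚ.≤ 1ℚ) × Admits G k θ ×
  (∀ η → 0ℚ ℚ.≤ η → η ℚ.≤ 1ℚ → Admits G k η → η ℚ.≤ θ)

-- χ*_DP(G) = c  (c a positive rational), where
-- χ*_DP(G) = inf { θ_DP(G,k)⁻¹ : k ≥ 1 }, with 0⁻¹ = ∞.
--   lower bound : c ≤ θ⁻¹        ⟺  c·θ ≤ 1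
--   greatest    : ∀ ε>0 ∃ k, θ⁻¹ < c + ε  ⟺  1 < (c+ε)·θ
IsχDP* : Graph → ℚ → Set
IsχDP* G c =
  (∀ k θ → 1 ≤ k → IsθDP G k θ → c ℚ.* θ ℚ.≤ 1ℚ) ×
  (∀ ε → 0ℚ ℚ.< ε → Σ ℕ λ k → Σ ℚ λ θ →
      (1 ≤ k) × IsθDP G k θ × (1ℚ ℚ.< (c ℚ.+ ε) ℚ.* θ))

{-# OPTIONS --safe #-}
module Submission where

-- Write 2s + 2 for the length of the cycle and j for the largest number with 2j + 1 ≤ k.
--
-- Lower bound θ ≥ j/k: extend the matching of every edge of a k-fold cover to an injection
-- of Fin k and compose these around the cycle; call the result σ.  Greedily build a set B of
-- j + 1 colours that σ maps into B except at one point w, and put A = ∁ B, C = B - w: both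
-- have at least j elements and σ[C] ⊆ B is disjoint from A.  Transporting A and C alternately
-- along the path gives j colours at every vertex with no cross-edge on the path, and none on
-- the closing edge either, because it joins the image of C to A.
--
-- Upper bound θ < (j + 1)/k: use identity matchings on the path and the cyclic shift on the
-- closing edge.  With j + 1 colours everywhere and k ≤ 2j + 2, the colour sets of adjacent
-- path vertices are complementary, so the last one is the complement of the first; the
-- closing edge then makes that complement closed under the shift, i.e. everything.
--
-- So θ_DP(C_{2s+2}, k) = j/k, which is below 1/2 but tends to 1/2 along k = 2j + 1.

open import Data.Bool using (true)
import Data.Bool as Bool
open import Data.Empty using (⊥; ⊥-elim)
open import Data.Fin using (Fin; zero; suc; toℕ; punchOut; fromℕ<; fromℕ; inject₁)
open import Data.Fin.Induction using (<-weakInduction; >-weakInduction)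
import Data.Fin.Properties as Fin
open import Data.Fin.Properties
  using (_≟_; any?; ¬∀⟶∃¬; 0≢1+n; toℕ-injective; toℕ-fromℕ<; toℕ<n; fromℕ≢inject₁;
         inject₁-injective; injective⇒≤; punchOut-injective)
open import Data.Fin.Subset
  using (Subset; _∈_; _∉_; _⊆_; ∣_∣; ⁅_⁆; _∪_; _-_; ∁; ⊤; inside; outside)
  renaming (⊥ to ∅)
open import Data.Fin.Subset.Properties
  using (_∈?_; ∉⊥; x∈⁅x⁆; x∈⁅y⁆⇒x≡y; x∈p∪q⁺; x∈p∪q⁻; x∈p∧x≢y⇒x∈p-y; p─q⊆p; x∉p⇒x∈∁p;
         x∈∁p⇒x∉p; ⊆-antisym; Empty-unique; p⊆q⇒∣p∣≤∣q∣; x∈p⇒∣p-x∣<∣p∣; ∣∁p∣≡n∸∣p∣; ∣p∣≤n;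
         ∣⁅x⁆∣≡1; ∣⊤∣≡n; ∣⊥∣≡0)
open import Data.Integer as ℤ using ()
import Data.Integer.Properties as ℤ
open import Data.List using (List; []; _∷_; allFin)
import Data.List.Membership.Propositional as List
open import Data.List.Membership.Propositional.Properties using (∈-allFin)
import Data.List.Relation.Unary.Any as Any
import Data.Nat as ℕ
open import Data.Nat using (ℕ; zero; suc; _+_; _*_; _∸_; _%_; _≤_; z≤n; s≤s; s≤s⁻¹; ⌊_/2⌋; NonZero)
open import Data.Nat.Coprimality using (Coprime)
open import Data.Nat.DivMod using (_mod_; m<n⇒m%n≡m; n%n≡0; %-congˡ)
open import Data.Nat.Properties
  using (≤-refl; ≤-reflexive; ≤-trans; ≤-antisym; <-trans; n≤1+n; n<1+n; <⇒≱; ≮⇒≥; >⇒≢;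
         1+n≰n; m≢1+n+m; suc-injective; m≤m+n; m+n≤o⇒m≤o∸n; m+[n∸m]≡n; +-comm; +-suc;
         +-identityʳ; +-mono-≤; +-monoʳ-≤; +-monoʳ-<; *-comm; *-identityˡ; *-identityʳ;
         *-monoˡ-≤; module ≤-Reasoning)
open import Data.Nat.Tactic.RingSolver using (solve-∀)
open import Data.Product using (Σ; ∃; _×_; _,_; proj₁; proj₂)
import Data.Product as Product
open import Data.Rational as ℚ using (ℚ; mkℚ; 0ℚ; 1ℚ; ½; _<_; toℚᵘ)
import Data.Rational.Properties as ℚ
open import Data.Rational.Unnormalised as ℚᵘ using (mkℚᵘ) renaming (_≃_ to _≃ᵘ_)
import Data.Rational.Unnormalised.Properties as ℚᵘ
open import Data.Sum using (_⊎_; inj₁; inj₂)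
import Data.Sum as Sum
open import Data.Vec using ([]; _∷_; here; there)
open import Function using (_∘_; id)
open import Function.Bundles using (Inverse; Equivalence; mk⇔)
open import Function.Definitions using (Injective)
open import Function.Properties.Bijection using (⤖⇒↔)
open import Relation.Binary.Definitions using (Decidable)
open import Relation.Binary.PropositionalEquality
  using (_≡_; _≢_; refl; sym; trans; cong; cong₂; subst; subst₂; module ≡-Reasoning)
open import Relation.Nullary using (¬_; Dec; does; yes; no; contradiction; _⊎-dec_; _×-dec_)
open import Relation.Nullary.Decidable using (dec-true; does-⇔)

open import Defs hiding (sym)

private
  variable
    m n : ℕ

-- Counting in subsets of Fin n

injection⇒∣p∣≤∣q∣ : (f : Fin m → Fin n) → Injective _≡_ _≡_ f →
  (p : Subset m) (q : Subset n) → (∀ {x} → x ∈ p → f x ∈ q) → ∣ p ∣ ≤ ∣ q ∣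
injection⇒∣p∣≤∣q∣ f f-inj [] q _ = z≤n
injection⇒∣p∣≤∣q∣ f f-inj (outside ∷ p) q f[p]⊆q =
  injection⇒∣p∣≤∣q∣ (f ∘ suc) (Fin.suc-injective ∘ f-inj) p q (f[p]⊆q ∘ there)
injection⇒∣p∣≤∣q∣ f f-inj (inside ∷ p) q f[p]⊆q =
  ≤-trans (s≤s ∣p∣≤∣q-f0∣) (x∈p⇒∣p-x∣<∣p∣ (f[p]⊆q here))
  where
  ∣p∣≤∣q-f0∣ : ∣ p ∣ ≤ ∣ q - f zero ∣
  ∣p∣≤∣q-f0∣ = injection⇒∣p∣≤∣q∣ (f ∘ suc) (Fin.suc-injective ∘ f-inj) p (q - f zero)
    (λ x∈p → x∈p∧x≢y⇒x∈p-y (f[p]⊆q (there x∈p)) (0≢1+n ∘ sym ∘ f-inj))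

∣p∪q∣≤∣p∣+∣q∣ : (p q : Subset n) → ∣ p ∪ q ∣ ≤ ∣ p ∣ + ∣ q ∣
∣p∪q∣≤∣p∣+∣q∣ []            []            = z≤n
∣p∪q∣≤∣p∣+∣q∣ (inside ∷ p)  (inside ∷ q)  =
  s≤s (≤-trans (∣p∪q∣≤∣p∣+∣q∣ p q) (+-monoʳ-≤ ∣ p ∣ (n≤1+n ∣ q ∣)))
∣p∪q∣≤∣p∣+∣q∣ (inside ∷ p)  (outside ∷ q) = s≤s (∣p∪q∣≤∣p∣+∣q∣ p q)
∣p∪q∣≤∣p∣+∣q∣ (outside ∷ p) (inside ∷ q)  =
  subst (suc ∣ p ∪ q ∣ ≤_) (sym (+-suc ∣ p ∣ ∣ q ∣)) (s≤s (∣p∪q∣≤∣p∣+∣q∣ p q))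
∣p∪q∣≤∣p∣+∣q∣ (outside ∷ p) (outside ∷ q) = ∣p∪q∣≤∣p∣+∣q∣ p q

x∉p-x : (p : Subset n) (x : Fin n) → x ∉ p - x
x∉p-x (_ ∷ p) zero    ()
x∉p-x (_ ∷ p) (suc x) (there x∈p-x) = x∉p-x p x x∈p-x

x∈p-y⇒x≢y : {p : Subset n} {x y : Fin n} → x ∈ p - y → x ≢ y
x∈p-y⇒x≢y {p = p} {y = y} x∈p-y refl = x∉p-x p y x∈p-y

∣p∣≤1+∣p-x∣ : (p : Subset n) (x : Fin n) → ∣ p ∣ ≤ suc ∣ p - x ∣
∣p∣≤1+∣p-x∣ p x = begin
  ∣ p ∣                   ≤⟨ p⊆q⇒∣p∣≤∣q∣ p⊆[p-x]∪⁅x⁆ ⟩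
  ∣ (p - x) ∪ ⁅ x ⁆ ∣     ≤⟨ ∣p∪q∣≤∣p∣+∣q∣ (p - x) ⁅ x ⁆ ⟩
  ∣ p - x ∣ + ∣ ⁅ x ⁆ ∣   ≡⟨ cong (∣ p - x ∣ +_) (∣⁅x⁆∣≡1 x) ⟩
  ∣ p - x ∣ + 1           ≡⟨ +-comm ∣ p - x ∣ 1 ⟩
  suc ∣ p - x ∣           ∎
  where
  open ≤-Reasoning
  p⊆[p-x]∪⁅x⁆ : p ⊆ (p - x) ∪ ⁅ x ⁆
  p⊆[p-x]∪⁅x⁆ {y} y∈p with y ≟ x
  ... | yes refl = x∈p∪q⁺ (inj₂ (x∈⁅x⁆ x))
  ... | no  y≢x  = x∈p∪q⁺ (inj₁ (x∈p∧x≢y⇒x∈p-y y∈p y≢x))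

x∉p⇒∣p∪⁅x⁆∣≡1+∣p∣ : {p : Subset n} {x : Fin n} → x ∉ p → ∣ p ∪ ⁅ x ⁆ ∣ ≡ suc ∣ p ∣
x∉p⇒∣p∪⁅x⁆∣≡1+∣p∣ {p = p} {x} x∉p = ≤-antisym
  (begin
    ∣ p ∪ ⁅ x ⁆ ∣      ≤⟨ ∣p∪q∣≤∣p∣+∣q∣ p ⁅ x ⁆ ⟩
    ∣ p ∣ + ∣ ⁅ x ⁆ ∣  ≡⟨ cong (∣ p ∣ +_) (∣⁅x⁆∣≡1 x) ⟩
    ∣ p ∣ + 1          ≡⟨ +-comm ∣ p ∣ 1 ⟩
    suc ∣ p ∣          ∎)
  (begin-strict
    ∣ p ∣                  ≤⟨ p⊆q⇒∣p∣≤∣q∣ p⊆[p∪⁅x⁆]-x ⟩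
    ∣ p ∪ ⁅ x ⁆ - x ∣      <⟨ x∈p⇒∣p-x∣<∣p∣ (x∈p∪q⁺ {p = p} (inj₂ (x∈⁅x⁆ x))) ⟩
    ∣ p ∪ ⁅ x ⁆ ∣          ∎)
  where
  open ≤-Reasoning
  p⊆[p∪⁅x⁆]-x : p ⊆ p ∪ ⁅ x ⁆ - x
  p⊆[p∪⁅x⁆]-x y∈p = x∈p∧x≢y⇒x∈p-y (x∈p∪q⁺ {q = ⁅ x ⁆} (inj₁ y∈p)) λ { refl → x∉p y∈p }

∣p∣<n⇒∃∉ : {p : Subset n} → ∣ p ∣ ℕ.< n → ∃ λ x → x ∉ p
∣p∣<n⇒∃∉ {n} {p} ∣p∣<n = ¬∀⟶∃¬ n (_∈ p) (_∈? p) λ all∈p →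
  <⇒≱ ∣p∣<n (subst (_≤ ∣ p ∣) (∣⊤∣≡n n) (p⊆q⇒∣p∣≤∣q∣ {p = ⊤} λ {x} _ → all∈p x))

0<∣p∣⇒∃∈ : {p : Subset n} → 0 ℕ.< ∣ p ∣ → ∃ (_∈ p)
0<∣p∣⇒∃∈ {n} {p} 0<∣p∣ with any? (_∈? p)
... | yes ∃x∈p = ∃x∈p
... | no  ∄x∈p = contradiction (trans (cong ∣_∣ (Empty-unique ∄x∈p)) (∣⊥∣≡0 n)) (>⇒≢ 0<∣p∣)

⊆∁⇒≡∁ : {p q : Subset n} → q ⊆ ∁ p → n ≤ ∣ p ∣ + ∣ q ∣ → q ≡ ∁ p
⊆∁⇒≡∁ {n} {p} {q} q⊆∁p n≤∣p∣+∣q∣ = ⊆-antisym q⊆∁p ∁p⊆q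
  where
  open ≤-Reasoning
  ∁p⊆q : ∁ p ⊆ q
  ∁p⊆q {x} x∈∁p with x ∈? q
  ... | yes x∈q = x∈q
  ... | no  x∉q = contradiction n≤∣p∣+∣q∣ (<⇒≱ (begin-strict
    ∣ p ∣ + ∣ q ∣         ≤⟨ +-monoʳ-≤ ∣ p ∣ (p⊆q⇒∣p∣≤∣q∣ q⊆∁p-x) ⟩
    ∣ p ∣ + ∣ ∁ p - x ∣   <⟨ +-monoʳ-< ∣ p ∣ (x∈p⇒∣p-x∣<∣p∣ x∈∁p) ⟩
    ∣ p ∣ + ∣ ∁ p ∣       ≡⟨ cong (∣ p ∣ +_) (∣∁p∣≡n∸∣p∣ p) ⟩
    ∣ p ∣ + (n ∸ ∣ p ∣)   ≡⟨ m+[n∸m]≡n (∣p∣≤n p) ⟩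
    n                     ∎))
    where
    q⊆∁p-x : q ⊆ ∁ p - x
    q⊆∁p-x y∈q = x∈p∧x≢y⇒x∈p-y (q⊆∁p y∈q) λ { refl → x∉q y∈q }

image : (Fin m → Fin n) → Subset m → Subset n
image f []            = ∅
image f (outside ∷ p) = image (f ∘ suc) p
image f (inside ∷ p)  = ⁅ f zero ⁆ ∪ image (f ∘ suc) p

∈-image⁺ : (f : Fin m → Fin n) {p : Subset m} {x : Fin m} → x ∈ p → f x ∈ image f p
∈-image⁺ f {inside ∷ p}  here        = x∈p∪q⁺ (inj₁ (x∈⁅x⁆ (f zero)))
∈-image⁺ f {inside ∷ p}  (there x∈p) = x∈p∪q⁺ (inj₂ (∈-image⁺ (f ∘ suc) x∈p))
∈-image⁺ f {outside ∷ p} (there x∈p) = ∈-image⁺ (f ∘ suc) x∈p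

∈-image⁻ : (f : Fin m → Fin n) (p : Subset m) {y : Fin n} →
  y ∈ image f p → ∃ λ x → x ∈ p × f x ≡ y
∈-image⁻ f [] y∈∅ = contradiction y∈∅ ∉⊥
∈-image⁻ f (outside ∷ p) y∈ with ∈-image⁻ (f ∘ suc) p y∈
... | x , x∈p , fx≡y = suc x , there x∈p , fx≡y
∈-image⁻ f (inside ∷ p) y∈ with x∈p∪q⁻ ⁅ f zero ⁆ (image (f ∘ suc) p) y∈
... | inj₁ y∈⁅f0⁆ = zero , here , sym (x∈⁅y⁆⇒x≡y (f zero) y∈⁅f0⁆)
... | inj₂ y∈ with ∈-image⁻ (f ∘ suc) p y∈
...   | x , x∈p , fx≡y = suc x , there x∈p , fx≡y

∣p∣≤∣image∣ : (f : Fin m → Fin n) → Injective _≡_ _≡_ f → (p : Subset m) → ∣ p ∣ ≤ ∣ image f p ∣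
∣p∣≤∣image∣ f f-inj p = injection⇒∣p∣≤∣q∣ f f-inj p (image f p) (∈-image⁺ f)

-- Partial matchings

injective⇒surjective : {h : Fin n → Fin n} → Injective _≡_ _≡_ h → ∀ x → ∃ λ y → h y ≡ x
injective⇒surjective {suc n} {h} h-inj x with any? (λ y → h y ≟ x)
... | yes hit  = hit
... | no  miss = contradiction (injective⇒≤ h′-inj) 1+n≰n
  where
  x≢h : ∀ y → x ≢ h y
  x≢h y x≡hy = miss (y , sym x≡hy)
  h′ : Fin (suc n) → Fin n
  h′ y = punchOut (x≢h y)
  h′-inj : Injective _≡_ _≡_ h′
  h′-inj {a} {b} h′a≡h′b = h-inj (punchOut-injective (x≢h a) (x≢h b) h′a≡h′b)

record PartialMatching (k : ℕ) : Set₁ where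
  field
    _∼_        : Fin k → Fin k → Set
    _∼?_       : Decidable _∼_
    functional : ∀ {i j j′} → i ∼ j → i ∼ j′ → j ≡ j′
    injective  : ∀ {i i′ j} → i ∼ j → i′ ∼ j → i ≡ i′

  Unmatched : Fin k → Set
  Unmatched x = ¬ ∃ (x ∼_)

  Unused : Fin k → Set
  Unused y = ¬ ∃ (_∼ y)

  unmatched⇒¬allUsed : ∀ {x} → Unmatched x → ¬ (∀ y → ∃ λ i → i ∼ y)
  unmatched⇒¬allUsed {x} x-unmatched used =
    let y , source≡x = injective⇒surjective source-injective x
    in  x-unmatched (y , subst (_∼ y) source≡x (proj₂ (used y)))
    where
    source-injective : Injective _≡_ _≡_ (λ y → proj₁ (used y))
    source-injective {a} {b} e = functional (proj₂ (used a)) (subst (_∼ b) (sym e) (proj₂ (used b)))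

  unused-exists : ∀ {x} → Unmatched x → ∃ Unused
  unused-exists x-unmatched = ¬∀⟶∃¬ k _ (λ y → any? (_∼? y)) (unmatched⇒¬allUsed x-unmatched)

  extendWith : ∀ x y → Unmatched x → Unused y → PartialMatching k
  extendWith x y x-unmatched y-unused = record
    { _∼_        = λ i j → i ∼ j ⊎ (i ≡ x × j ≡ y)
    ; _∼?_       = λ i j → (i ∼? j) ⊎-dec ((i ≟ x) ×-dec (j ≟ y))
    ; functional = λ where
        (inj₁ i∼j)        (inj₁ i∼j′)       → functional i∼j i∼j′
        (inj₁ x∼j)        (inj₂ (refl , _)) → contradiction (_ , x∼j) x-unmatched
        (inj₂ (refl , _)) (inj₁ x∼j′)       → contradiction (_ , x∼j′) x-unmatched
        (inj₂ (_ , refl)) (inj₂ (_ , refl)) → refl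
    ; injective  = λ where
        (inj₁ i∼j)        (inj₁ i′∼j)       → injective i∼j i′∼j
        (inj₁ i∼y)        (inj₂ (_ , refl)) → contradiction (_ , i∼y) y-unused
        (inj₂ (_ , refl)) (inj₁ i′∼y)       → contradiction (_ , i′∼y) y-unused
        (inj₂ (refl , _)) (inj₂ (refl , _)) → refl
    }

module _ {k : ℕ} where
  open PartialMatching

  _⊑_ : PartialMatching k → PartialMatching k → Set
  M ⊑ M′ = ∀ {i j} → _∼_ M i j → _∼_ M′ i j

  matchAll : (M : PartialMatching k) (xs : List (Fin k)) →
    ∃ λ M′ → M ⊑ M′ × (∀ {x} → x List.∈ xs → ∃ (_∼_ M′ x))
  matchAll M [] = M , id , λ ()
  matchAll M (x ∷ xs) with matchAll M xs
  ... | M₁ , M⊑M₁ , matched with any? (_∼?_ M₁ x)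
  ...   | yes x-matched = M₁ , M⊑M₁ , λ where
          (Any.here refl)  → x-matched
          (Any.there x∈xs) → matched x∈xs
  ...   | no  x-unmatched with unused-exists M₁ x-unmatched
  ...     | y , y-unused = extendWith M₁ x y x-unmatched y-unused , inj₁ ∘ M⊑M₁ , λ where
          (Any.here refl)  → y , inj₂ (refl , refl)
          (Any.there x∈xs) → Product.map₂ inj₁ (matched x∈xs)

  extendsToInjection : (M : PartialMatching k) →
    ∃ λ (e : Fin k → Fin k) → Injective _≡_ _≡_ e × (∀ {i j} → _∼_ M i j → e i ≡ j)
  extendsToInjection M with matchAll M (allFin k)
  ... | M′ , M⊑M′ , matched = e , e-injective , e-extends
    where
    total : ∀ x → ∃ (_∼_ M′ x)
    total x = matched (∈-allFin x)
    e : Fin k → Fin k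
    e x = proj₁ (total x)
    e-injective : Injective _≡_ _≡_ e
    e-injective {a} {b} ea≡eb =
      injective M′ (proj₂ (total a)) (subst (_∼_ M′ b) (sym ea≡eb) (proj₂ (total b)))
    e-extends : ∀ {i j} → _∼_ M i j → e i ≡ j
    e-extends i∼j = functional M′ (proj₂ (total _)) (M⊑M′ i∼j)

-- Colorings along a cycle of injections

record AlmostClosed {k : ℕ} (σ : Fin k → Fin k) (r : ℕ) : Set where
  field
    B       : Subset k
    end     : Fin k
    ∣B∣≡1+r : ∣ B ∣ ≡ suc r
    closed  : ∀ {c} → c ∈ B - end → σ c ∈ B

module _ {k : ℕ} (σ : Fin k → Fin k) where

  newEnd : (B : Subset k) (w : Fin k) → ∣ B ∣ ℕ.< k → ∃ λ z → z ∉ B × σ w ∈ B ∪ ⁅ z ⁆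
  newEnd B w ∣B∣<k with σ w ∈? B
  ... | no  σw∉B = σ w , σw∉B , x∈p∪q⁺ {p = B} (inj₂ (x∈⁅x⁆ (σ w)))
  ... | yes σw∈B = let z , z∉B = ∣p∣<n⇒∃∉ ∣B∣<k in z , z∉B , x∈p∪q⁺ {q = ⁅ z ⁆} (inj₁ σw∈B)

  almostClosed : ∀ r → suc r ≤ k → AlmostClosed σ r
  almostClosed zero 1≤k = record
    { B       = ⁅ x ⁆
    ; end     = x
    ; ∣B∣≡1+r = ∣⁅x⁆∣≡1 x
    ; closed  = λ c∈⁅x⁆-x →
        contradiction (x∈⁅y⁆⇒x≡y x (p─q⊆p ⁅ x ⁆ ⁅ x ⁆ c∈⁅x⁆-x)) (x∈p-y⇒x≢y c∈⁅x⁆-x)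
    }
    where
    x : Fin k
    x = fromℕ< 1≤k
  almostClosed (suc r) 2+r≤k with almostClosed r (≤-trans (n≤1+n _) 2+r≤k)
  ... | record { B = B ; end = end ; ∣B∣≡1+r = ∣B∣≡1+r ; closed = closed }
    with newEnd B end (subst (ℕ._< k) (sym ∣B∣≡1+r) 2+r≤k)
  ...   | z , z∉B , σend∈B∪⁅z⁆ = record
    { B       = B ∪ ⁅ z ⁆
    ; end     = z
    ; ∣B∣≡1+r = trans (x∉p⇒∣p∪⁅x⁆∣≡1+∣p∣ z∉B) (cong suc ∣B∣≡1+r)
    ; closed  = closed′
    }
    where
    closed′ : ∀ {c} → c ∈ B ∪ ⁅ z ⁆ - z → σ c ∈ B ∪ ⁅ z ⁆
    closed′ {c} c∈ with x∈p∪q⁻ B ⁅ z ⁆ (p─q⊆p _ ⁅ z ⁆ c∈) | c ≟ end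
    ... | inj₂ c∈⁅z⁆ | _         = contradiction (x∈⁅y⁆⇒x≡y z c∈⁅z⁆) (x∈p-y⇒x≢y c∈)
    ... | inj₁ c∈B   | yes refl  = σend∈B∪⁅z⁆
    ... | inj₁ c∈B   | no  c≢end = x∈p∪q⁺ {q = ⁅ z ⁆} (inj₁ (closed (x∈p∧x≢y⇒x∈p-y c∈B c≢end)))

  separatedPair : ∀ j → suc (j + j) ≤ k →
    ∃ λ B → ∃ λ C → j ≤ ∣ ∁ B ∣ × j ≤ ∣ C ∣ × C ⊆ B × (∀ {c} → c ∈ C → σ c ∈ B)
  separatedPair j 2j+1≤k = B , B - end , j≤∣∁B∣ , j≤∣C∣ , p─q⊆p B _ , closed
    where
    open AlmostClosed (almostClosed j (≤-trans (s≤s (m≤m+n j j)) 2j+1≤k))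
    j≤∣∁B∣ : j ≤ ∣ ∁ B ∣
    j≤∣∁B∣ = subst (j ≤_) (sym (trans (∣∁p∣≡n∸∣p∣ B) (cong (k ∸_) ∣B∣≡1+r)))
      (m+n≤o⇒m≤o∸n j (subst (_≤ k) (+-comm (suc j) j) 2j+1≤k))
    j≤∣C∣ : j ≤ ∣ B - end ∣
    j≤∣C∣ = s≤s⁻¹ (subst (_≤ suc ∣ B - end ∣) ∣B∣≡1+r (∣p∣≤1+∣p-x∣ B end))

alternate : Subset n → Subset n → ℕ → Subset n
alternate a c zero    = a
alternate a c (suc p) = alternate c a p

alternate-preserves : (P : Subset n → Set) {a c : Subset n} → P a → P c → ∀ p → P (alternate a c p)
alternate-preserves P Pa Pc zero    = Pa
alternate-preserves P Pa Pc (suc p) = alternate-preserves P Pc Pa p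

alternate-disjoint : {a c : Subset n} → (∀ {x} → x ∈ a → x ∉ c) →
  ∀ p {x} → x ∈ alternate a c p → x ∉ alternate a c (suc p)
alternate-disjoint a∩c≡∅ zero    = a∩c≡∅
alternate-disjoint a∩c≡∅ (suc p) = alternate-disjoint (λ x∈c x∈a → a∩c≡∅ x∈a x∈c) p

alternate-odd : (a c : Subset n) (s : ℕ) → alternate a c (suc (s + s)) ≡ c
alternate-odd a c zero    = refl
alternate-odd a c (suc s) = trans (cong (alternate a c) (+-suc s s)) (alternate-odd a c s)

module _ {k : ℕ} (e : ℕ → Fin k → Fin k) (e-injective : ∀ p → Injective _≡_ _≡_ (e p)) where

  walk : ℕ → Fin k → Fin k
  walk zero    = id
  walk (suc p) = e p ∘ walk p

  walk-injective : ∀ p → Injective _≡_ _≡_ (walk p)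
  walk-injective zero    = id
  walk-injective (suc p) = walk-injective p ∘ e-injective p

  injectionCycleColoring : ∀ s j → suc (j + j) ≤ k → ∃ λ (S : ℕ → Subset k) →
    (∀ p → j ≤ ∣ S p ∣) ×
    (∀ p {i} → i ∈ S p → e p i ∉ S (suc p)) ×
    (∀ {i} → i ∈ S (suc (s + s)) → e (suc (s + s)) i ∉ S 0)
  injectionCycleColoring s j 2j+1≤k with separatedPair (walk (suc (suc (s + s)))) j 2j+1≤k
  ... | B , C , j≤∣∁B∣ , j≤∣C∣ , C⊆B , σ[C]⊆B = S , j≤∣S∣ , pathEdge , closingEdge
    where
    last : ℕ
    last = suc (s + s)

    X : ℕ → Subset k
    X = alternate (∁ B) C

    S : ℕ → Subset k
    S p = image (walk p) (X p)

    j≤∣S∣ : ∀ p → j ≤ ∣ S p ∣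
    j≤∣S∣ p = ≤-trans (alternate-preserves (λ Y → j ≤ ∣ Y ∣) j≤∣∁B∣ j≤∣C∣ p)
                      (∣p∣≤∣image∣ (walk p) (walk-injective p) (X p))

    pathEdge : ∀ p {i} → i ∈ S p → e p i ∉ S (suc p)
    pathEdge p {i} i∈Sp epi∈S[1+p]
      with a , a∈Xp , walk-a≡i ← ∈-image⁻ (walk p) (X p) i∈Sp
         | c , c∈X[1+p] , walk-c≡epi ← ∈-image⁻ (walk (suc p)) (X (suc p)) epi∈S[1+p] =
      alternate-disjoint (λ x∈∁B x∈C → x∈∁p⇒x∉p x∈∁B (C⊆B x∈C)) p a∈Xp
        (subst (_∈ X (suc p))
          (walk-injective (suc p) (trans walk-c≡epi (cong (e p) (sym walk-a≡i)))) c∈X[1+p])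

    closingEdge : ∀ {i} → i ∈ S last → e last i ∉ S 0
    closingEdge {i} i∈S-last ei∈S0
      with c , c∈X-last , walk-c≡i ← ∈-image⁻ (walk last) (X last) i∈S-last
         | a , a∈∁B , a≡ei ← ∈-image⁻ id (∁ B) ei∈S0 =
      x∈∁p⇒x∉p a∈∁B (subst (_∈ B) (trans (cong (e last) walk-c≡i) (sym a≡ei))
        (σ[C]⊆B (subst (c ∈_) (alternate-odd (∁ B) C s) c∈X-last)))

cyclicPred : Fin (suc n) → Fin (suc n)
cyclicPred {n} zero = fromℕ n
cyclicPred (suc i)  = inject₁ i

cyclicPred-injective : Injective _≡_ _≡_ (cyclicPred {n})
cyclicPred-injective {x = zero}  {zero}  _ = refl
cyclicPred-injective {x = zero}  {suc j} e = contradiction e fromℕ≢inject₁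
cyclicPred-injective {x = suc i} {zero}  e = contradiction (sym e) fromℕ≢inject₁
cyclicPred-injective {x = suc i} {suc j} e = cong suc (inject₁-injective e)

cyclicPred-closed⇒all : (P : Fin (suc n) → Set) → (∀ {i} → P i → P (cyclicPred i)) →
  ∀ {x} → P x → ∀ i → P i
cyclicPred-closed⇒all {n} P closed {x} Px = >-weakInduction P P-last (λ _ → closed)
  where
  P⇒P0 : ∀ i → P i → P zero
  P⇒P0 = <-weakInduction (λ i → P i → P zero) id (λ _ P[i]⇒P0 → P[i]⇒P0 ∘ closed)
  P-last : P (fromℕ n)
  P-last = closed (P⇒P0 x Px)

-- Covers of a cycle

module Positions {G : Graph} {n : ℕ} .{{_ : NonZero n}} (iso : IsCycle n G) where
  open Inverse (⤖⇒↔ (proj₁ iso)) public using (to)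
  open Inverse (⤖⇒↔ (proj₁ iso)) using (from; strictlyInverseˡ; strictlyInverseʳ)

  pos : Fin (V G) → ℕ
  pos u = toℕ (to u)

  -- Positions are read modulo n, so the closing arc of the cycle joins vertexAt (n - 1) to
  -- vertexAt n = vertexAt 0, just like the other arcs.
  vertexAt : ℕ → Fin (V G)
  vertexAt p = from (p mod n)

  vertexAt≡ : ∀ {p v} → p % n ≡ pos v → vertexAt p ≡ v
  vertexAt≡ {p} {v} p%n≡v =
    trans (cong from (toℕ-injective (trans (toℕ-fromℕ< _) p%n≡v))) (strictlyInverseʳ v)

  pos-vertexAt : ∀ {p} → p ℕ.< n → pos (vertexAt p) ≡ p
  pos-vertexAt {p} p<n =
    trans (cong toℕ (strictlyInverseˡ (p mod n))) (trans (toℕ-fromℕ< _) (m<n⇒m%n≡m p<n))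

  adjacent⇒Succ : ∀ {u v} → Adj G u v → Succ n (to u) (to v) ⊎ Succ n (to v) (to u)
  adjacent⇒Succ {u} {v} = Equivalence.to (proj₂ iso u v)

  Succ⇒adjacent : ∀ {u v} → Succ n (to u) (to v) → Adj G u v
  Succ⇒adjacent {u} {v} = Equivalence.from (proj₂ iso u v) ∘ inj₁

  Succ⇒vertexAt : ∀ {u v} → Succ n (to u) (to v) → u ≡ vertexAt (pos u) × v ≡ vertexAt (suc (pos u))
  Succ⇒vertexAt {u} {v} u→v = sym (vertexAt≡ (m<n⇒m%n≡m (toℕ<n (to u)))) , sym (vertexAt≡ (next u→v))
    where
    next : Succ n (to u) (to v) → suc (pos u) % n ≡ pos v
    next (inj₁ 1+u≡v)         = trans (m<n⇒m%n≡m (subst (ℕ._< n) (sym 1+u≡v) (toℕ<n (to v)))) 1+u≡v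
    next (inj₂ (1+u≡n , v≡0)) = trans (%-congˡ 1+u≡n) (trans (n%n≡0 n) (sym v≡0))

Succ-asym : {a b : Fin n} → 3 ≤ n → Succ n a b → Succ n b a → ⊥
Succ-asym {a = a} {b} 3≤n = asym (toℕ a) (toℕ b) 3≤n
  where
  asym : ∀ {n} x y → 3 ≤ n → (suc x ≡ y ⊎ (suc x ≡ n × y ≡ 0)) → (suc y ≡ x ⊎ (suc y ≡ n × x ≡ 0)) → ⊥
  asym x _ _               (inj₁ refl)          (inj₁ 2+x≡x)         = m≢1+n+m x (sym 2+x≡x)
  asym _ _ (s≤s (s≤s ()))  (inj₁ refl)          (inj₂ (refl , refl))
  asym _ _ (s≤s (s≤s ()))  (inj₂ (refl , refl)) (inj₁ refl)

module _ {n k : ℕ} (τ : Fin k → Fin k) where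

  TwistedArc : Fin n → Fin k → Fin n → Fin k → Set
  TwistedArc a i b j = (suc (toℕ a) ≡ toℕ b × i ≡ j) ⊎ ((suc (toℕ a) ≡ n × toℕ b ≡ 0) × τ i ≡ j)

  twistedArc? : ∀ a i b j → Dec (TwistedArc a i b j)
  twistedArc? a i b j = ((suc (toℕ a) ℕ.≟ toℕ b) ×-dec (i ≟ j))
                 ⊎-dec (((suc (toℕ a) ℕ.≟ n) ×-dec (toℕ b ℕ.≟ 0)) ×-dec (τ i ≟ j))

  twistedArc⇒Succ : ∀ {a i b j} → TwistedArc a i b j → Succ n a b
  twistedArc⇒Succ = Sum.map proj₁ proj₁

  twistedArc-functional : ∀ {a i b j j′} → TwistedArc a i b j → TwistedArc a i b j′ → j ≡ j′
  twistedArc-functional (inj₁ (_ , refl))      (inj₁ (_ , refl))      = refl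
  twistedArc-functional (inj₂ (_ , refl))      (inj₂ (_ , refl))      = refl
  twistedArc-functional (inj₁ (1+a≡b , _))     (inj₂ ((_ , b≡0) , _)) = contradiction (trans 1+a≡b b≡0) λ ()
  twistedArc-functional (inj₂ ((_ , b≡0) , _)) (inj₁ (1+a≡b , _))     = contradiction (trans 1+a≡b b≡0) λ ()

  twistedArc-injective : Injective _≡_ _≡_ τ →
    ∀ {a i i′ b j} → TwistedArc a i b j → TwistedArc a i′ b j → i ≡ i′
  twistedArc-injective τ-inj (inj₁ (_ , refl))      (inj₁ (_ , refl))      = refl
  twistedArc-injective τ-inj (inj₂ (_ , τi≡j))      (inj₂ (_ , τi′≡j))     = τ-inj (trans τi≡j (sym τi′≡j))
  twistedArc-injective τ-inj (inj₁ (1+a≡b , _))     (inj₂ ((_ , b≡0) , _)) = contradiction (trans 1+a≡b b≡0) λ ()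
  twistedArc-injective τ-inj (inj₂ ((_ , b≡0) , _)) (inj₁ (1+a≡b , _))     = contradiction (trans 1+a≡b b≡0) λ ()

dec-true⁻¹ : {A : Set} (a? : Dec A) → does a? ≡ true → A
dec-true⁻¹ (yes a) _ = a

module TwistedCover {G : Graph} {n k : ℕ} .{{_ : NonZero n}} (iso : IsCycle n G) (3≤n : 3 ≤ n)
  (τ : Fin k → Fin k) (τ-injective : Injective _≡_ _≡_ τ) where
  open Positions {G} iso

  Linked : Fin (V G) → Fin k → Fin (V G) → Fin k → Set
  Linked u i v j = TwistedArc τ (to u) i (to v) j ⊎ TwistedArc τ (to v) j (to u) i

  linked? : ∀ u i v j → Dec (Linked u i v j)
  linked? u i v j = twistedArc? τ (to u) i (to v) j ⊎-dec twistedArc? τ (to v) j (to u) i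

  linked-functional : ∀ {u i v j j′} → Linked u i v j → Linked u i v j′ → j ≡ j′
  linked-functional (inj₁ a) (inj₁ a′) = twistedArc-functional τ a a′
  linked-functional (inj₂ a) (inj₂ a′) = twistedArc-injective τ τ-injective a a′
  linked-functional (inj₁ a) (inj₂ a′) = ⊥-elim (Succ-asym 3≤n (twistedArc⇒Succ τ a) (twistedArc⇒Succ τ a′))
  linked-functional (inj₂ a) (inj₁ a′) = ⊥-elim (Succ-asym 3≤n (twistedArc⇒Succ τ a) (twistedArc⇒Succ τ a′))

  twistedCover : Cover G k
  twistedCover = record
    { cross     = λ u i v j → does (linked? u i v j)
    ; cross-sym = λ u i v j → does-⇔ (mk⇔ Sum.swap Sum.swap) (linked? u i v j) (linked? v j u i)
    ; cross-adj = λ {u} {i} {v} {j} c →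
        Sum.[ Succ⇒adjacent ∘ twistedArc⇒Succ τ , Graph.sym G ∘ Succ⇒adjacent ∘ twistedArc⇒Succ τ ]
          (dec-true⁻¹ (linked? u i v j) c)
    ; matching  = λ {u} {i} {v} {j} {j′} c c′ →
        linked-functional (dec-true⁻¹ (linked? u i v j) c) (dec-true⁻¹ (linked? u i v j′) c′)
    }

  pathLink : ∀ {p} i → suc p ℕ.< n → cross twistedCover (vertexAt p) i (vertexAt (suc p)) i ≡ true
  pathLink {p} i 1+p<n = dec-true (linked? _ i _ i)
    (inj₁ (inj₁ (trans (cong suc (pos-vertexAt (<-trans (n<1+n p) 1+p<n))) (sym (pos-vertexAt 1+p<n)) , refl)))

  closingLink : ∀ {p} i → suc p ≡ n → cross twistedCover (vertexAt p) i (vertexAt 0) (τ i) ≡ true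
  closingLink {p} i 1+p≡n = dec-true (linked? _ i _ (τ i))
    (inj₁ (inj₂ ((trans (cong suc (pos-vertexAt p<n)) 1+p≡n , pos-vertexAt (≤-trans (s≤s z≤n) p<n)) , refl)))
    where
    p<n : p ℕ.< n
    p<n = subst (p ℕ.<_) 1+p≡n (n<1+n p)

arcMatching : {G : Graph} {k : ℕ} (H : Cover G k) (u v : Fin (V G)) → PartialMatching k
arcMatching H u v = record
  { _∼_        = λ i j → cross H u i v j ≡ true
  ; _∼?_       = λ i j → cross H u i v j Bool.≟ true
  ; functional = matching H
  ; injective  = λ {i} {i′} {j} i∼j i′∼j →
      matching H (trans (cross-sym H v j u i) i∼j) (trans (cross-sym H v j u i′) i′∼j)
  }

-- Fractions of natural numbers

-- ℚ./ normalises by a gcd that does not compute on variables, so rationals are compared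
-- through the unnormalised fraction a / (1 + b).
infix 4 _≃_/1+_

_≃_/1+_ : ℚ → ℕ → ℕ → Set
p ≃ a /1+ b = toℚᵘ p ≃ᵘ mkℚᵘ (ℤ.+ a) b

ℕ→ℚ-≃ : ∀ m → ℕ→ℚ m ≃ m /1+ 0
ℕ→ℚ-≃ m = ℚ.toℚᵘ-fromℚᵘ (mkℚᵘ (ℤ.+ m) 0)

mkℚ-≃ : ∀ a b .(c : Coprime a (suc b)) → mkℚ (ℤ.+ a) b c ≃ a /1+ b
mkℚ-≃ a b c = ℚᵘ.≃-refl

/-≃ : ∀ a b → ℤ.+ a ℚ./ suc b ≃ a /1+ b
/-≃ a b = ℚ.toℚᵘ-fromℚᵘ (mkℚᵘ (ℤ.+ a) b)

*-≃ : ∀ {p q a b c d} → p ≃ a /1+ b → q ≃ c /1+ d → p ℚ.* q ≃ a * c /1+ (d + b * suc d)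
*-≃ {p} {q} {a} {b} {c} {d} p≃ q≃ = ℚᵘ.≃-trans (ℚ.toℚᵘ-homo-* p q)
  (ℚᵘ.≃-trans (ℚᵘ.*-cong p≃ q≃) (ℚᵘ.≃-reflexive (cong (λ z → mkℚᵘ z (d + b * suc d)) (sym (ℤ.pos-* a c)))))

+-≃ : ∀ {p q a b c d} → p ≃ a /1+ b → q ≃ c /1+ d →
  p ℚ.+ q ≃ a * suc d + c * suc b /1+ (d + b * suc d)
+-≃ {p} {q} {a} {b} {c} {d} p≃ q≃ = ℚᵘ.≃-trans (ℚ.toℚᵘ-homo-+ p q)
  (ℚᵘ.≃-trans (ℚᵘ.+-cong p≃ q≃) (ℚᵘ.≃-reflexive (cong (λ z → mkℚᵘ z (d + b * suc d))
    (trans (cong₂ ℤ._+_ (sym (ℤ.pos-* a (suc d))) (sym (ℤ.pos-* c (suc b))))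
           (sym (ℤ.pos-+ (a * suc d) (c * suc b)))))))

≃-≤ : ∀ {p q a b c d} → p ≃ a /1+ b → q ≃ c /1+ d → a * suc d ≤ c * suc b → p ℚ.≤ q
≃-≤ {a = a} {b} {c} {d} p≃ q≃ ad≤cb = ℚ.toℚᵘ-cancel-≤
  (ℚᵘ.≤-respˡ-≃ (ℚᵘ.≃-sym p≃) (ℚᵘ.≤-respʳ-≃ (ℚᵘ.≃-sym q≃)
    (ℚᵘ.*≤* (subst₂ ℤ._≤_ (ℤ.pos-* a (suc d)) (ℤ.pos-* c (suc b)) (ℤ.+≤+ ad≤cb)))))

≃-< : ∀ {p q a b c d} → p ≃ a /1+ b → q ≃ c /1+ d → a * suc d ℕ.< c * suc b → p < q
≃-< {a = a} {b} {c} {d} p≃ q≃ ad<cb = ℚ.toℚᵘ-cancel-<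
  (ℚᵘ.<-respˡ-≃ (ℚᵘ.≃-sym p≃) (ℚᵘ.<-respʳ-≃ (ℚᵘ.≃-sym q≃)
    (ℚᵘ.*<* (subst₂ ℤ._<_ (ℤ.pos-* a (suc d)) (ℤ.pos-* c (suc b)) (ℤ.+<+ ad<cb)))))

ℕ→ℚ-mono-≤ : m ≤ n → ℕ→ℚ m ℚ.≤ ℕ→ℚ n
ℕ→ℚ-mono-≤ {m} {n} m≤n = ≃-≤ (ℕ→ℚ-≃ m) (ℕ→ℚ-≃ n) (*-monoˡ-≤ 1 m≤n)

ℕ→ℚ-suc-positive : ∀ n → ℚ.Positive (ℕ→ℚ (suc n))
ℕ→ℚ-suc-positive n = ℚ.positive (≃-< ℚᵘ.≃-refl (ℕ→ℚ-≃ (suc n)) (s≤s z≤n))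

/-*-cancel : ∀ a b → (ℤ.+ a ℚ./ suc b) ℚ.* ℕ→ℚ (suc b) ≡ ℕ→ℚ a
/-*-cancel a b = ℚ.≤-antisym (≃-≤ a/[1+b]*[1+b]≃ (ℕ→ℚ-≃ a) (≤-reflexive cross-multiplied))
                             (≃-≤ (ℕ→ℚ-≃ a) a/[1+b]*[1+b]≃ (≤-reflexive (sym cross-multiplied)))
  where
  a/[1+b]*[1+b]≃ : (ℤ.+ a ℚ./ suc b) ℚ.* ℕ→ℚ (suc b) ≃ a * suc b /1+ (0 + b * 1)
  a/[1+b]*[1+b]≃ = *-≃ (/-≃ a b) (ℕ→ℚ-≃ (suc b))
  cross-multiplied : a * suc b * 1 ≡ a * suc (0 + b * 1)
  cross-multiplied = trans (*-identityʳ (a * suc b)) (cong (λ x → a * suc x) (sym (*-identityʳ b)))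

0≤/ : ∀ a b → 0ℚ ℚ.≤ ℤ.+ a ℚ./ suc b
0≤/ a b = ≃-≤ ℚᵘ.≃-refl (/-≃ a b) z≤n

/≤1 : ∀ {a b} → a ≤ suc b → ℤ.+ a ℚ./ suc b ℚ.≤ 1ℚ
/≤1 {a} {b} a≤1+b = ≃-≤ (/-≃ a b) ℚᵘ.≃-refl
  (subst₂ _≤_ (sym (*-identityʳ a)) (sym (*-identityˡ (suc b))) a≤1+b)

/<½ : ∀ {a b} → a + a ℕ.< suc b → ℤ.+ a ℚ./ suc b < ½
/<½ {a} {b} 2a<1+b = ≃-< (/-≃ a b) ℚᵘ.≃-refl
  (subst₂ ℕ._<_ (sym (trans (*-comm a 2) (cong (a +_) (+-identityʳ a)))) (sym (*-identityˡ (suc b))) 2a<1+b)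

1<[2+ε]*j/[2j+1] : ∀ {ε a b} j → ε ≃ a /1+ b → suc b ℕ.< a * j →
  1ℚ < (ℕ→ℚ 2 ℚ.+ ε) ℚ.* (ℤ.+ j ℚ./ suc (j + j))
1<[2+ε]*j/[2j+1] {ε} {a} {b} j ε≃ 1+b<aj =
  ≃-< ℚᵘ.≃-refl (*-≃ (+-≃ (ℕ→ℚ-≃ 2) ε≃) (/-≃ j (j + j)))
    (subst₂ ℕ._<_ (sym (denominator b j)) (sym (numerator a b j)) (+-monoʳ-< (suc b * j + suc b * j) 1+b<aj))
  where
  denominator : ∀ b j → 1 * suc ((j + j) + (b + 0 * suc b) * suc (j + j)) ≡ (suc b * j + suc b * j) + suc b
  denominator = solve-∀
  numerator : ∀ a b j → ((2 * suc b + a * 1) * j) * suc 0 ≡ (suc b * j + suc b * j) + a * j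
  numerator = solve-∀

-- Even cycles

module EvenCycle {G : Graph} (s : ℕ) (iso : IsCycle (suc (suc (s + s))) G) where
  open Positions {G} iso

  module _ {k : ℕ} (H : Cover G k) where
    arc : ℕ → PartialMatching k
    arc p = arcMatching H (vertexAt p) (vertexAt (suc p))

    e : ℕ → Fin k → Fin k
    e p = proj₁ (extendsToInjection (arc p))

    e-injective : ∀ p → Injective _≡_ _≡_ (e p)
    e-injective p = proj₁ (proj₂ (extendsToInjection (arc p)))

    e-extends : ∀ {u v i j} → Succ _ (to u) (to v) → cross H u i v j ≡ true → e (pos u) i ≡ j
    e-extends {u} {v} {i} {j} u→v c with Succ⇒vertexAt u→v
    ... | u≡ , v≡ = proj₂ (proj₂ (extendsToInjection (arc (pos u))))
                      (subst₂ (λ a b → cross H a i b j ≡ true) u≡ v≡ c)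

    quasiIndependentOfSize : ∀ j → suc (j + j) ≤ k →
      ∃ λ S → QuasiIndependent H S × (∀ u → j ≤ ∣ S u ∣)
    quasiIndependentOfSize j 2j+1≤k with injectionCycleColoring e e-injective s j 2j+1≤k
    ... | T , j≤∣T∣ , pathEdge , closingEdge = T ∘ pos , T∘pos-independent , j≤∣T∣ ∘ pos
      where
      noCrossEdge : ∀ {u v i j} → Succ _ (to u) (to v) → cross H u i v j ≡ true →
        i ∈ T (pos u) → j ∉ T (pos v)
      noCrossEdge {u} {v} {i} {j} u→v c i∈ j∈ with u→v
      ... | inj₁ 1+u≡v =
        pathEdge (pos u) i∈ (subst₂ (λ x q → x ∈ T q) (sym (e-extends u→v c)) (sym 1+u≡v) j∈)
      ... | inj₂ (1+u≡n , v≡0) =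
        closingEdge (subst (λ q → i ∈ T q) u≡last i∈)
          (subst₂ (λ x q → x ∈ T q) (sym (trans (cong (λ q → e q i) (sym u≡last)) (e-extends u→v c))) v≡0 j∈)
        where
        u≡last : pos u ≡ suc (s + s)
        u≡last = suc-injective 1+u≡n

      T∘pos-independent : QuasiIndependent H (T ∘ pos)
      T∘pos-independent u i v j c i∈ j∈ with adjacent⇒Succ (cross-adj H c)
      ... | inj₁ u→v = noCrossEdge u→v c i∈ j∈
      ... | inj₂ v→u = noCrossEdge v→u (trans (cross-sym H v j u i) c) j∈ i∈

  module _ (1≤s : 1 ≤ s) where
    3≤N : 3 ≤ suc (suc (s + s))
    3≤N = s≤s (s≤s (≤-trans 1≤s (m≤m+n s s)))

    module _ {m : ℕ} where
      open TwistedCover {G} iso 3≤N (cyclicPred {m}) cyclicPred-injective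

      noQuasiIndependentOfSize : ∀ j → suc m ≤ suc j + suc j → (S : Fin (V G) → Subset (suc m)) →
        QuasiIndependent twistedCover S → ¬ (∀ u → suc j ≤ ∣ S u ∣)
      noQuasiIndependentOfSize j 1+m≤2j+2 S S-independent large =
        contradiction (proj₂ (nonempty 0)) (allOutside _)
        where
        N : ℕ
        N = suc (suc (s + s))

        T : ℕ → Subset (suc m)
        T p = S (vertexAt p)

        nonempty : ∀ p → ∃ (_∈ T p)
        nonempty p = 0<∣p∣⇒∃∈ (≤-trans (s≤s z≤n) (large (vertexAt p)))

        apart : ∀ p → suc p ℕ.< N → ∀ {x} → x ∈ T p → x ∉ T (suc p)
        apart p 1+p<N {x} = S-independent (vertexAt p) x (vertexAt (suc p)) x (pathLink x 1+p<N)

        fills : ∀ p q → suc m ≤ ∣ T p ∣ + ∣ T q ∣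
        fills p q = ≤-trans 1+m≤2j+2 (+-mono-≤ (large (vertexAt p)) (large (vertexAt q)))

        next≡∁ : ∀ p → suc p ℕ.< N → T (suc p) ≡ ∁ (T p)
        next≡∁ p 1+p<N =
          ⊆∁⇒≡∁ (λ x∈T[1+p] → x∉p⇒x∈∁p λ x∈Tp → apart p 1+p<N x∈Tp x∈T[1+p]) (fills p (suc p))

        prev≡∁ : ∀ p → suc p ℕ.< N → T p ≡ ∁ (T (suc p))
        prev≡∁ p 1+p<N = ⊆∁⇒≡∁ (x∉p⇒x∈∁p ∘ apart p 1+p<N) (fills (suc p) p)

        odd≡∁ : ∀ r → suc (r + r) ℕ.< N → T (suc (r + r)) ≡ ∁ (T 0)
        odd≡∁ zero    1<N     = next≡∁ 0 1<N
        odd≡∁ (suc r) 2r+3<N′ = begin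
          T (suc (suc (r + suc r)))  ≡⟨ cong (λ q → T (2 + q)) (+-suc r r) ⟩
          T (3 + (r + r))            ≡⟨ next≡∁ (2 + (r + r)) 2r+3<N ⟩
          ∁ (T (2 + (r + r)))        ≡⟨ sym (prev≡∁ (suc (r + r)) (<-trans (n<1+n _) 2r+3<N)) ⟩
          T (suc (r + r))            ≡⟨ odd≡∁ r (<-trans (n<1+n _) (<-trans (n<1+n _) 2r+3<N)) ⟩
          ∁ (T 0)                    ∎
          where
          open ≡-Reasoning
          2r+3<N : 3 + (r + r) ℕ.< N
          2r+3<N = subst (λ q → suc (suc q) ℕ.< N) (+-suc r r) 2r+3<N′

        outside-closed : ∀ {i} → i ∉ T 0 → cyclicPred i ∉ T 0
        outside-closed {i} i∉T0 =
          S-independent (vertexAt (suc (s + s))) i (vertexAt 0) (cyclicPred i) (closingLink i refl)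
            (subst (i ∈_) (sym (odd≡∁ s (n<1+n _))) (x∉p⇒x∈∁p i∉T0))

        allOutside : ∀ i → i ∉ T 0
        allOutside = cyclicPred-closed⇒all (_∉ T 0) outside-closed
          (x∈∁p⇒x∉p (subst (proj₁ (nonempty 1) ∈_) (next≡∁ 0 (s≤s (s≤s z≤n))) (proj₂ (nonempty 1))))

    isθDP : ∀ b j → suc (j + j) ≤ suc b → suc b ≤ suc j + suc j → IsθDP G (suc b) (ℤ.+ j ℚ./ suc b)
    isθDP b j 2j+1≤1+b 1+b≤2j+2 =
      0≤/ j b , /≤1 (≤-trans (m≤m+n j j) (≤-trans (n≤1+n _) 2j+1≤1+b)) , admits , maximal
      where
      θ : ℚ
      θ = ℤ.+ j ℚ./ suc b

      θ*k≤ : ∀ {m} → j ≤ m → θ ℚ.* ℕ→ℚ (suc b) ℚ.≤ ℕ→ℚ m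
      θ*k≤ j≤m = ℚ.≤-trans (ℚ.≤-reflexive (/-*-cancel j b)) (ℕ→ℚ-mono-≤ j≤m)

      admits : Admits G (suc b) θ
      admits H =
        let S , S-independent , j≤∣S∣ = quasiIndependentOfSize H j 2j+1≤1+b
        in  S , S-independent , λ u → θ*k≤ (j≤∣S∣ u)

      maximal : ∀ η → 0ℚ ℚ.≤ η → η ℚ.≤ 1ℚ → Admits G (suc b) η → η ℚ.≤ θ
      maximal η _ _ η-admits
        with S , S-independent , η-large ←
               η-admits (TwistedCover.twistedCover iso 3≤N (cyclicPred {b}) cyclicPred-injective)
        with u , ∣Su∣≯j ← ¬∀⟶∃¬ _ (λ u → suc j ≤ ∣ S u ∣) (λ u → suc j ℕ.≤? ∣ S u ∣)
                                   (noQuasiIndependentOfSize j 1+b≤2j+2 S S-independent) =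
        ℚ.*-cancelʳ-≤-pos (ℕ→ℚ (suc b)) {{ℕ→ℚ-suc-positive b}} (begin
          η ℚ.* ℕ→ℚ (suc b)   ≤⟨ η-large u ⟩
          ℕ→ℚ ∣ S u ∣          ≤⟨ ℕ→ℚ-mono-≤ (≮⇒≥ ∣Su∣≯j) ⟩
          ℕ→ℚ j                ≡⟨ sym (/-*-cancel j b) ⟩
          θ ℚ.* ℕ→ℚ (suc b)   ∎)
        where open ℚ.≤-Reasoning

⌊n/2⌋-bounds : ∀ n → ⌊ n /2⌋ + ⌊ n /2⌋ ≤ n × n ≤ suc (⌊ n /2⌋ + ⌊ n /2⌋)
⌊n/2⌋-bounds zero          = z≤n , z≤n
⌊n/2⌋-bounds (suc zero)    = z≤n , s≤s z≤n
⌊n/2⌋-bounds (suc (suc n)) =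
  let lo , hi = ⌊n/2⌋-bounds n
  in  s≤s (subst (_≤ suc n) (sym (+-suc h h)) (s≤s lo)) ,
      s≤s (subst (suc n ≤_) (cong suc (sym (+-suc h h))) (s≤s hi))
  where
  h : ℕ
  h = ⌊ n /2⌋

2*[1+s]≡2+[s+s] : ∀ s → 2 * suc s ≡ suc (suc (s + s))
2*[1+s]≡2+[s+s] s = cong suc (trans (cong (λ x → s + suc x) (+-identityʳ s)) (+-suc s s))

lemma3p2 : (G : Graph) (t : ℕ) → 2 ≤ t → IsCycle (2 * t) G →
    IsχDP* G (ℕ→ℚ 2) ×
    (∀ k → 1 ≤ k → Σ ℚ λ θ → IsθDP G k θ × θ < ½)
lemma3p2 G (suc s) (s≤s 1≤s) iso = (2θ≤1 , 1<[2+ε]θ) , θ<½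
  where
  open EvenCycle s (subst (λ n → IsCycle n G) (2*[1+s]≡2+[s+s] s) iso)

  θₖ : ∀ b → IsθDP G (suc b) (ℤ.+ ⌊ b /2⌋ ℚ./ suc b)
  θₖ b = let lo , hi = ⌊n/2⌋-bounds b
         in  isθDP 1≤s b ⌊ b /2⌋ (s≤s lo) (s≤s (subst (b ≤_) (sym (+-suc _ _)) hi))

  θₖ<½ : ∀ b → ℤ.+ ⌊ b /2⌋ ℚ./ suc b < ½
  θₖ<½ b = /<½ {⌊ b /2⌋} {b} (s≤s (proj₁ (⌊n/2⌋-bounds b)))

  θ<½ : ∀ k → 1 ≤ k → Σ ℚ λ θ → IsθDP G k θ × θ < ½
  θ<½ (suc b) _ = _ , θₖ b , θₖ<½ b

  2θ≤1 : ∀ k θ → 1 ≤ k → IsθDP G k θ → ℕ→ℚ 2 ℚ.* θ ℚ.≤ 1ℚ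
  2θ≤1 (suc b) θ _ (0≤θ , θ≤1 , θ-admits , _) =
    let _ , _ , _ , θₖ-maximal = θₖ b
    in  ℚ.*-monoˡ-≤-nonNeg (ℕ→ℚ 2) (ℚ.<⇒≤ (ℚ.≤-<-trans (θₖ-maximal θ 0≤θ θ≤1 θ-admits) (θₖ<½ b)))

  -- For ε = (a + 1)/(b + 1) take k = 2j + 1 with j = b + 2, so that εj > 1.
  1<[2+ε]θ : ∀ ε → 0ℚ < ε → Σ ℕ λ k → Σ ℚ λ θ →
    (1 ≤ k) × IsθDP G k θ × (1ℚ < (ℕ→ℚ 2 ℚ.+ ε) ℚ.* θ)
  1<[2+ε]θ (mkℚ (ℤ.+ zero) _ _) (ℚ.*<* (ℤ.+<+ ()))
  1<[2+ε]θ (mkℚ ℤ.-[1+ _ ] _ _) (ℚ.*<* ())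
  1<[2+ε]θ ε@(mkℚ (ℤ.+ suc a) b c) _ =
    suc (j + j) , _ , s≤s z≤n ,
    isθDP 1≤s (j + j) j ≤-refl (s≤s (≤-trans (n≤1+n _) (≤-reflexive (sym (+-suc j j))))) ,
    1<[2+ε]*j/[2j+1] {ε} j (mkℚ-≃ (suc a) b c) (m≤m+n j (a * j))
    where
    j : ℕ
    j = suc (suc b)
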